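{- Let $n\geq 1$ be an integer and let $m=(3(2n+1))^2+1$. Suppose $m$ is square-free. Then the class number $h(m)$ of the real quadratic field $\mathbb{Q}(\sqrt{m})$ satisfies $h(m)>1$.
   Context: For a square-free positive integer $m$, $h(m)$ denotes the class number of the real quadratic field $k_m=\mathbb{Q}(\sqrt{m})$. -}

module Defs where

open import Level using (Level; suc; zero)
open import Data.Nat as ℕ using (ℕ; _%_; _/_)
open import Data.Nat.Divisibility using (_∣_)
open import Data.Integer as ℤ using (ℤ; +_; _+_; _*_)
open import Data.Product using (_×_; _,_; Σ; ∃; ∃-syntax)
open import Relation.Binary.PropositionalEquality using (_≡_; _≢_)
open import Relation.Nullary using (¬_)
open import Function.Bundles using (_⇔_)

SquareFree : ℕ → Set
SquareFree m = (d : ℕ) → (d ℕ.* d) ∣ m → d ≡ 1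

-- Ring of integers O_m of Q(√m), m square-free, m ≠ 1.
-- An element (x , y) represents x + y·ω, where
--   ω = (1 + √m)/2   if m ≡ 1 (mod 4)   (so ω² = ω + (m-1)/4),
--   ω = √m           otherwise           (so ω² = m).
-- {1, ω} is the standard Z-basis of O_m.
O : Set
O = ℤ × ℤ

0O : O
0O = (+ 0 , + 0)

_+O_ : O → O → O
(a , b) +O (c , d) = (a + c , b + d)

mulO : ℕ → O → O → O
mulO m (a , b) (c , d) with m % 4
... | 1 = (a * c + b * d * (+ (m / 4)) , a * d + b * c + b * d)
... | _ = (a * c + (+ m) * (b * d) , a * d + b * c)

record IsIdeal (m : ℕ) (I : O → Set) : Set where
  field
    has-zero : I 0O
    +-closed : ∀ {x y} → I x → I y → I (x +O y)
    *-closed : ∀ r {x} → I x → I (mulO m r x)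

NonZeroIdeal : ℕ → (O → Set) → Set
NonZeroIdeal m I = IsIdeal m I × (∃[ x ] (x ≢ 0O × I x))

Principal : ℕ → (O → Set) → Set
Principal m I = ∃[ g ] (∀ x → I x ⇔ (∃[ r ] (x ≡ mulO m g r)))

-- h(m) > 1, i.e. the ideal class group of O_m is nontrivial, i.e. some
-- nonzero ideal of O_m is not principal (every ideal class contains a
-- nonzero integral ideal, and the trivial class consists of the principal ones).
ClassNumberGreaterThanOne : ℕ → Set₁
ClassNumberGreaterThanOne m =
  Σ (O → Set) λ I → NonZeroIdeal m I × ¬ Principal m I

{-# OPTIONS --safe #-}
-- With m = 9(2n+1)² + 1 we have m ≡ 10 (mod 72), so O_m = ℤ[√m] and m ≡ 1 (mod 3).
-- The ideal P = (3, 1 + √m) then consists of the x + y√m with x ≡ y (mod 3); every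
-- element of P has norm divisible by 3. If P = (g), then N(g) divides N(3) = 9 and
-- N(4 + √m) = 16 - m ≡ 6 (mod 9), hence divides 3, so N(g) = ±3. But
-- x² - my² ≡ x² - 2y² (mod 8), and x² - 2y² never takes the values ±3 modulo 8.
module Submission where

open import Defs
open import Data.Nat as ℕ using (ℕ; _%_)
open import Data.Nat.DivMod using (m∣n⇒o%n%m≡o%m; [m+kn]%n≡m%n)
import Data.Nat.Divisibility as ℕ
open import Data.Product using (_,_; proj₁)
open import Relation.Binary.PropositionalEquality
  using (_≡_; _≢_; refl; sym; trans; cong; cong₂; subst)

m%n≡r⇒m%d≡r%d : ∀ m d {n r} .{{_ : ℕ.NonZero n}} .{{_ : ℕ.NonZero d}} →
  d ℕ.∣ n → m % n ≡ r → m % d ≡ r % d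
m%n≡r⇒m%d≡r%d m d {n} d∣n refl = sym (m∣n⇒o%n%m≡o%m d n m d∣n)

m%8≡2⇒m%4≢1 : ∀ m → m % 8 ≡ 2 → m % 4 ≢ 1
m%8≡2⇒m%4≢1 m m%8≡2 m%4≡1
  with () ← trans (sym (m%n≡r⇒m%d≡r%d m 4 (ℕ.divides 2 refl) m%8≡2)) m%4≡1

module ℤ[√m] where

  open import Data.Integer using (ℤ; +_; -[1+_]; -_; _+_; _-_; _*_; ∣_∣)
  open import Data.Integer.DivMod using (_%ℕ_; _/ℕ_; a≡a%ℕn+[a/ℕn]*n; n%ℕd<d)
  open import Data.Integer.Divisibility.Signed
  open import Data.Integer.Properties using (*-comm)
  open import Data.Integer.Tactic.RingSolver using (solve-∀)
  open import Data.Nat using (_<_; allUpTo?)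
  open import Data.Product using (_×_; proj₂)
  open import Function.Bundles using (module Equivalence)
  open import Relation.Nullary using (¬_; ¬?; Dec)
  open import Relation.Nullary.Decidable using (from-yes; _×-dec_)

  m%n≡r⇒+m≡+r+[m/n]*n : ∀ m {n r} .{{_ : ℕ.NonZero n}} →
    m % n ≡ r → + m ≡ + r + (+ m /ℕ n) * + n
  m%n≡r⇒+m≡+r+[m/n]*n m {n} refl = a≡a%ℕn+[a/ℕn]*n (+ m) n

  mul√ : ℕ → O → O → O
  mul√ m (a , b) (c , d) = (a * c + + m * (b * d) , a * d + b * c)

  mulO≡mul√ : ∀ m → m % 4 ≢ 1 → ∀ g h → mulO m g h ≡ mul√ m g h
  mulO≡mul√ m m%4≢1 (a , b) (c , d) with m % 4
  ... | 0 = refl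
  ... | 1 with () ← m%4≢1 refl
  ... | ℕ.suc (ℕ.suc _) = refl

  mul√-identityʳ : ∀ m g → mul√ m g (+ 1 , + 0) ≡ g
  mul√-identityʳ m (a , b) = cong₂ _,_ (a*1+m*[b*0]≡a a b (+ m)) (a*0+b*1≡b a b)
    where
    a*1+m*[b*0]≡a : ∀ a b m → a * + 1 + m * (b * + 0) ≡ a
    a*1+m*[b*0]≡a = solve-∀
    a*0+b*1≡b : ∀ a b → a * + 0 + b * + 1 ≡ b
    a*0+b*1≡b = solve-∀

  norm : ℕ → O → ℤ
  norm m (a , b) = a * a - + m * (b * b)

  norm-mul√ : ∀ m g h → norm m (mul√ m g h) ≡ norm m g * norm m h
  norm-mul√ m (a , b) (c , d) = brahmagupta a b c d (+ m)
    where
    brahmagupta : ∀ a b c d m →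
      (a * c + m * (b * d)) * (a * c + m * (b * d)) - m * ((a * d + b * c) * (a * d + b * c))
        ≡ (a * a - m * (b * b)) * (c * c - m * (d * d))
    brahmagupta = solve-∀

  norm∣norm-mul√ : ∀ m g r → norm m g ∣ norm m (mul√ m g r)
  norm∣norm-mul√ m g r =
    divides (norm m r) (trans (norm-mul√ m g r) (*-comm (norm m g) (norm m r)))

  norm-generator∣norm : ∀ {m I} → m % 4 ≢ 1 → (principal : Principal m I) →
    ∀ x → I x → norm m (proj₁ principal) ∣ norm m x
  norm-generator∣norm {m} m%4≢1 (g , I⇔gO) x x∈I
    with (r , x≡gr) ← Equivalence.to (I⇔gO x) x∈I =
    subst (λ x → norm m g ∣ norm m x) (sym (trans x≡gr (mulO≡mul√ m m%4≢1 g r)))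
      (norm∣norm-mul√ m g r)

  generator∈ideal : ∀ {m I} → m % 4 ≢ 1 → (principal : Principal m I) → I (proj₁ principal)
  generator∈ideal {m} m%4≢1 (g , I⇔gO) = Equivalence.from (I⇔gO g)
    ((+ 1 , + 0) , sym (trans (mulO≡mul√ m m%4≢1 g (+ 1 , + 0)) (mul√-identityʳ m g)))

  P₃ : O → Set
  P₃ (x , y) = + 3 ∣ x - y

  P₃-isIdeal : ∀ {m} → m % 4 ≢ 1 → m % 3 ≡ 1 → IsIdeal m P₃
  P₃-isIdeal {m} m%4≢1 m%3≡1 = record
    { has-zero = divides (+ 0) refl
    ; +-closed = λ {x} {y} → +-closed x y
    ; *-closed = *-closed
    }
    where
    L : ℤ
    L = + m /ℕ 3
    m≡1+3L : + m ≡ + 1 + L * + 3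
    m≡1+3L = m%n≡r⇒+m≡+r+[m/n]*n m m%3≡1

    +-closed : ∀ x y → P₃ x → P₃ y → P₃ (x +O y)
    +-closed (a , b) (c , d) 3∣a-b 3∣c-d =
      subst (+ 3 ∣_) (difference a b c d) (∣m∣n⇒∣m+n 3∣a-b 3∣c-d)
      where
      difference : ∀ a b c d → (a - b) + (c - d) ≡ (a + c) - (b + d)
      difference = solve-∀

    *-closed : ∀ r {x} → P₃ x → P₃ (mulO m r x)
    *-closed (p , q) {a , b} 3∣a-b = subst P₃ (sym (mulO≡mul√ m m%4≢1 (p , q) (a , b)))
      (subst (+ 3 ∣_) (sym difference)
        (∣m∣n⇒∣m+n (∣n⇒∣m*n (p - q) 3∣a-b) (divides (L * (q * b)) refl)))
      where
      factor : ∀ p q a b L → (p * a + (+ 1 + L * + 3) * (q * b)) - (p * b + q * a)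
                               ≡ (p - q) * (a - b) + L * (q * b) * + 3
      factor = solve-∀
      difference : (p * a + + m * (q * b)) - (p * b + q * a)
                     ≡ (p - q) * (a - b) + L * (q * b) * + 3
      difference = trans (cong (λ M → (p * a + M * (q * b)) - (p * b + q * a)) m≡1+3L)
                         (factor p q a b L)

  3∣norm-P₃ : ∀ m → m % 3 ≡ 1 → ∀ g → P₃ g → + 3 ∣ norm m g
  3∣norm-P₃ m m%3≡1 (x , y) 3∣x-y =
    subst (+ 3 ∣_) (sym norm≡)
      (∣m∣n⇒∣m-n (∣m⇒∣m*n (x + y) 3∣x-y) (divides (L * (y * y)) refl))
    where
    L : ℤ
    L = + m /ℕ 3
    factor : ∀ x y L →
      x * x - (+ 1 + L * + 3) * (y * y) ≡ (x - y) * (x + y) - L * (y * y) * + 3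
    factor = solve-∀
    norm≡ : norm m (x , y) ≡ (x - y) * (x + y) - L * (y * y) * + 3
    norm≡ = trans (cong (λ M → x * x - M * (y * y)) (m%n≡r⇒+m≡+r+[m/n]*n m m%3≡1))
                  (factor x y L)

  x²-2y²≢±3-mod8-table : ∀ {r} → r < 8 → ∀ {s} → s < 8 →
    ¬ (+ 8 ∣ (+ r * + r - + 2 * (+ s * + s)) - + 3)
      × ¬ (+ 8 ∣ (+ r * + r - + 2 * (+ s * + s)) - - + 3)
  x²-2y²≢±3-mod8-table = from-yes (allUpTo? (λ r → allUpTo? (excluded r) 8) 8)
    where
    excluded : ∀ r s → Dec (¬ (+ 8 ∣ (+ r * + r - + 2 * (+ s * + s)) - + 3)
                              × ¬ (+ 8 ∣ (+ r * + r - + 2 * (+ s * + s)) - - + 3))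
    excluded r s = ¬? (+ 8 ∣? (+ r * + r - + 2 * (+ s * + s)) - + 3)
            ×-dec ¬? (+ 8 ∣? (+ r * + r - + 2 * (+ s * + s)) - - + 3)

  x²-2y²≢±3-mod8 : ∀ x y {d} → ∣ d ∣ ≡ 3 → ¬ (+ 8 ∣ (x * x - + 2 * (y * y)) - d)
  x²-2y²≢±3-mod8 x y {d} ∣d∣≡3 8∣ = on-residues (n%ℕd<d x 8) (n%ℕd<d y 8) ∣d∣≡3
    (∣m+n∣n⇒∣m (subst (+ 8 ∣_) reduce 8∣) (divides q refl))
    where
    r s : ℕ
    r = x %ℕ 8
    s = y %ℕ 8
    a b q : ℤ
    a = x /ℕ 8
    b = y /ℕ 8
    q = + 2 * + r * a + + 8 * a * a - + 4 * + s * b - + 16 * b * b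
    expand : ∀ r s a b d →
      ((r + a * + 8) * (r + a * + 8) - + 2 * ((s + b * + 8) * (s + b * + 8))) - d
        ≡ ((r * r - + 2 * (s * s)) - d)
          + (+ 2 * r * a + + 8 * a * a - + 4 * s * b - + 16 * b * b) * + 8
    expand = solve-∀
    reduce : (x * x - + 2 * (y * y)) - d ≡ ((+ r * + r - + 2 * (+ s * + s)) - d) + q * + 8
    reduce = trans (cong₂ (λ x y → (x * x - + 2 * (y * y)) - d)
                          (a≡a%ℕn+[a/ℕn]*n x 8) (a≡a%ℕn+[a/ℕn]*n y 8))
                   (expand (+ r) (+ s) a b d)
    on-residues : ∀ {r s d} → r < 8 → s < 8 → ∣ d ∣ ≡ 3 →
      ¬ (+ 8 ∣ (+ r * + r - + 2 * (+ s * + s)) - d)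
    on-residues {d = + _}      r<8 s<8 refl = proj₁ (x²-2y²≢±3-mod8-table r<8 s<8)
    on-residues {d = -[1+ _ ]} r<8 s<8 refl = proj₂ (x²-2y²≢±3-mod8-table r<8 s<8)

  ∣norm∣≢3 : ∀ m → m % 8 ≡ 2 → ∀ g → ∣ norm m g ∣ ≢ 3
  ∣norm∣≢3 m m%8≡2 (x , y) ∣N∣≡3 =
    x²-2y²≢±3-mod8 x y ∣N∣≡3 (divides (J * (y * y)) difference)
    where
    J : ℤ
    J = + m /ℕ 8
    factor : ∀ x y J →
      (x * x - + 2 * (y * y)) - (x * x - (+ 2 + J * + 8) * (y * y)) ≡ J * (y * y) * + 8
    factor = solve-∀
    difference : (x * x - + 2 * (y * y)) - norm m (x , y) ≡ J * (y * y) * + 8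
    difference =
      trans (cong (λ M → (x * x - + 2 * (y * y)) - (x * x - M * (y * y)))
                  (m%n≡r⇒+m≡+r+[m/n]*n m m%8≡2))
            (factor x y J)

  P₃-nonPrincipal : ∀ {m} → m % 8 ≡ 2 → m % 9 ≡ 1 → ¬ Principal m P₃
  P₃-nonPrincipal {m} m%8≡2 m%9≡1 P₃=gO@(g , _) =
    ∣norm∣≢3 m m%8≡2 g (ℕ.∣-antisym (∣⇒∣ᵤ N∣3) (∣⇒∣ᵤ 3∣N))
    where
    m%4≢1 : m % 4 ≢ 1
    m%4≢1 = m%8≡2⇒m%4≢1 m m%8≡2
    K : ℤ
    K = + m /ℕ 9
    combination : ∀ K → (+ 2 - K) * (+ 3 * + 3 - (+ 1 + K * + 9) * (+ 0 * + 0))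
                          - (+ 4 * + 4 - (+ 1 + K * + 9) * (+ 1 * + 1)) ≡ + 3
    combination = solve-∀
    three : (+ 2 - K) * norm m (+ 3 , + 0) - norm m (+ 4 , + 1) ≡ + 3
    three = trans (cong (λ M → (+ 2 - K) * (+ 3 * + 3 - M * (+ 0 * + 0))
                                - (+ 4 * + 4 - M * (+ 1 * + 1)))
                        (m%n≡r⇒+m≡+r+[m/n]*n m m%9≡1))
                  (combination K)
    N∣3 : norm m g ∣ + 3
    N∣3 = subst (norm m g ∣_) three (∣m∣n⇒∣m-n
      (∣n⇒∣m*n (+ 2 - K) (norm-generator∣norm m%4≢1 P₃=gO (+ 3 , + 0) (divides (+ 1) refl)))
      (norm-generator∣norm m%4≢1 P₃=gO (+ 4 , + 1) (divides (+ 1) refl)))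
    3∣N : + 3 ∣ norm m g
    3∣N = 3∣norm-P₃ m (m%n≡r⇒m%d≡r%d m 3 (ℕ.divides 3 refl) m%9≡1) g
            (generator∈ideal m%4≢1 P₃=gO)

  classNumber>1 : ∀ {m} → m % 8 ≡ 2 → m % 9 ≡ 1 → ClassNumberGreaterThanOne m
  classNumber>1 {m} m%8≡2 m%9≡1 =
    P₃ , (P₃-isIdeal m%4≢1 m%3≡1 , (+ 3 , + 0) , (λ ()) , divides (+ 1) refl)
       , P₃-nonPrincipal m%8≡2 m%9≡1
    where
    m%4≢1 : m % 4 ≢ 1
    m%4≢1 = m%8≡2⇒m%4≢1 m m%8≡2
    m%3≡1 : m % 3 ≡ 1
    m%3≡1 = m%n≡r⇒m%d≡r%d m 3 (ℕ.divides 3 refl) m%9≡1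

open ℤ[√m] using (classNumber>1)
open import Data.Nat using (ℕ; zero; suc; _+_; _*_; _≥_)
open import Data.Nat.Tactic.RingSolver using (solve-∀)

[3[2n+1]]²+1%72≡10 : ∀ n → ((3 * (2 * n + 1)) * (3 * (2 * n + 1)) + 1) % 72 ≡ 10
[3[2n+1]]²+1%72≡10 zero    = refl
[3[2n+1]]²+1%72≡10 (suc n) =
  trans (cong (_% 72) (step n))
        (trans ([m+kn]%n≡m%n mₙ (suc n) 72) ([3[2n+1]]²+1%72≡10 n))
  where
  mₙ : ℕ
  mₙ = (3 * (2 * n + 1)) * (3 * (2 * n + 1)) + 1
  step : ∀ n → (3 * (2 * suc n + 1)) * (3 * (2 * suc n + 1)) + 1
               ≡ ((3 * (2 * n + 1)) * (3 * (2 * n + 1)) + 1) + suc n * 72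
  step = solve-∀

proposition2p2 : (n : ℕ) → n ≥ 1 →
    SquareFree ((3 * (2 * n + 1)) * (3 * (2 * n + 1)) + 1) →
    ClassNumberGreaterThanOne ((3 * (2 * n + 1)) * (3 * (2 * n + 1)) + 1)
proposition2p2 n _ _ = classNumber>1 (m%n≡r⇒m%d≡r%d m 8 (ℕ.divides 9 refl) m%72≡10)
                                      (m%n≡r⇒m%d≡r%d m 9 (ℕ.divides 8 refl) m%72≡10)
  where
  m : ℕ
  m = (3 * (2 * n + 1)) * (3 * (2 * n + 1)) + 1
  m%72≡10 : m % 72 ≡ 10
  m%72≡10 = [3[2n+1]]²+1%72≡10 n
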